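{- Let $a,b$ be positive integers and let $h_j=h^{a,b}_j$ denote the number of tilings of the honeycomb strip $H_j$ by monomers of $a$ colors and dimers of $b$ colors, with $h_0=1$ and $h_j=0$ for $j<0$. Let $F_j$ be the Fibonacci numbers ($F_0=0$, $F_1=1$, $F_{j}=F_{j-1}+F_{j-2}$). Then for every integer $n\ge 0$, $$h_{2n}-b^nF_{n+1}=a\sum_{k=0}^{n}b^k\,h_{2n-2k-1}\,F_{k+2}$$ and $$h_{2n-1}=a\sum_{k=0}^{n}b^k\,h_{2n-2k-2}\,F_{k+2}.$$
   Context: The honeycomb strip $H_n$ consists of $n$ regular hexagons arranged in two rows, numbered $1,\dots,n$ from the bottom left so that odd-numbered hexagons form the bottom row and even-numbered ones the top row; hexagon $i$ shares an edge with hexagons $i\pm1$ and $i\pm2$ (when they exist), and with no others. A monomer is a single hexagon; a dimer is a pair of edge-adjacent hexagons, i.e. either $\{i,i+1\}$ (slanted) or $\{i,i+2\}$ (horizontal). A tiling of $H_n$ is a partition of its hexagons into monomers and dimers; in a colored tiling each monomer receives one of $a$ colors and each dimer one of $b$ colors. -}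

module Defs where

open import Data.Nat using (ℕ; zero; suc; _+_; _*_; _∸_; _^_; _<ᵇ_; _≤ᵇ_)
open import Data.Integer using (ℤ; +_; -[1+_])
open import Data.Bool using (Bool; true; false; _∧_)
open import Data.Maybe using (Maybe; just; nothing)
open import Data.List using (List; []; _∷_; length; map; filter; upTo; concatMap)
open import Data.Bool.ListAction using (and)
open import Data.Nat.ListAction using (sum)
open import Relation.Binary.PropositionalEquality using (_≡_)
open import Data.Bool.Properties using () renaming (_≟_ to _≟B_)

-- Hexagons of H_n are indexed 0,…,n-1 (hexagon i here = hexagon i+1 of the paper).
-- Hexagon i is edge-adjacent exactly to i±1 and i±2.
-- A tiling is encoded by recording, for each hexagon, which tile covers it:
--   mono : the hexagon is a monomer
--   slR  : slanted dimer {i, i+1}, this is its lower hexagon i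
--   slL  : slanted dimer {i-1, i}, this is its upper hexagon i
--   hoR  : horizontal dimer {i, i+2}, this is hexagon i
--   hoL  : horizontal dimer {i-2, i}, this is hexagon i
data Tile : Set where
  mono slR slL hoR hoL : Tile

_==_ : Tile → Tile → Bool
mono == mono = true
slR == slR = true
slL == slL = true
hoR == hoR = true
hoL == hoL = true
_ == _ = false

at : List Tile → ℕ → Maybe Tile
at [] _ = nothing
at (x ∷ xs) zero = just x
at (x ∷ xs) (suc i) = at xs i

is : Maybe Tile → Tile → Bool
is nothing _ = false
is (just x) y = x == y

validAt : List Tile → ℕ → Bool
validAt t i with at t i
... | nothing = false
... | just mono = true
... | just slR = is (at t (suc i)) slL
... | just slL = (1 ≤ᵇ i) ∧ is (at t (i ∸ 1)) slR
... | just hoR = is (at t (suc (suc i))) hoL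
... | just hoL = (2 ≤ᵇ i) ∧ is (at t (i ∸ 2)) hoR

isTiling : ℕ → List Tile → Bool
isTiling n t = and (map (validAt t) (upTo n))

allTiles : List Tile
allTiles = mono ∷ slR ∷ slL ∷ hoR ∷ hoL ∷ []

words : ℕ → List (List Tile)
words zero = [] ∷ []
words (suc n) = concatMap (λ x → map (x ∷_) (words n)) allTiles

count : Tile → List Tile → ℕ
count x [] = 0
count x (y ∷ ys) with x == y
... | true = suc (count x ys)
... | false = count x ys

colorings : ℕ → ℕ → List Tile → ℕ
colorings a b t = a ^ count mono t * b ^ (count slR t + count hoR t)

tilings : ℕ → List (List Tile)
tilings n = filter (λ t → isTiling n t ≟B true) (words n)

h : ℕ → ℕ → ℕ → ℕ
h a b n = sum (map (colorings a b) (tilings n))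

hℤ : ℕ → ℕ → ℤ → ℕ
hℤ a b (+ n) = h a b n
hℤ a b -[1+ _ ] = 0

fib : ℕ → ℕ
fib zero = 0
fib (suc zero) = 1
fib (suc (suc n)) = fib (suc n) + fib n

Σ≤ : ℕ → (ℕ → ℕ) → ℕ
Σ≤ n f = sum (map f (upTo (suc n)))

-- Read from the left, a tiling of H_n splits uniquely into blocks: a monomer (weight a), a slanted
-- dimer (b), a horizontal dimer around a monomer (ab), or two interlocking horizontal dimers (b²).
-- Hence h_{n+1} = a h_n + b h_{n-1} + ab h_{n-2} + b² h_{n-3} for all n ≥ 0. On the indices of one
-- parity this reads x_{j+2} = b x_{j+1} + b² x_j + a (w_{j+2} + b w_{j+1}), with w the terms of the
-- other parity. Since Σ_k b^k F_{k+2} t^k = (1 + bt)/(1 - bt - b²t²), the convolution of w with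
-- b^k F_{k+2} solves the inhomogeneous part; the homogeneous solution b^j F_{j+1} accounts for h_0 = 1
-- on the even indices. Two solutions with the same two initial values agree.
module Submission where

open import Defs
open import Data.Nat using (ℕ; zero; suc; _+_; _*_; _^_; _≥_; _∸_; _≤_; _<_; s≤s; z≤n)
open import Data.Nat.Properties
open import Data.Nat.Solver using (module +-*-Solver)
open import Data.Integer using (+_; -[1+_]; _⊖_) renaming (_-_ to _-ℤ_; _+_ to _+ℤ_)
open import Data.Integer.Properties using ([+m]-[+n]≡m⊖n; [1+m]⊖[1+n]≡m⊖n; distribˡ-⊖-+-neg)
open import Data.Bool using (Bool; true; false; _∧_; if_then_else_)
open import Data.Bool.Properties using (∧-assoc; ∧-zeroʳ) renaming (_≟_ to _≟B_)
open import Data.Maybe using (just; nothing)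
open import Data.List using (List; []; _∷_; _++_; length; map; filter; applyUpTo; upTo; concatMap)
open import Data.List.Properties using (map-++; map-∘; map-cong; map-applyUpTo)
open import Data.Bool.ListAction using (and)
open import Data.Nat.ListAction using (sum)
open import Data.Nat.ListAction.Properties using (sum-++)
open import Data.Product using (_×_; _,_; proj₁)
open import Data.Unit using (⊤; tt)
open import Relation.Binary.PropositionalEquality

open +-*-Solver using (solve; _:+_; _:*_; _:=_; con)

cong₃ : ∀ {A B C D : Set} (f : A → B → C → D) {x x′ y y′ z z′} →
  x ≡ x′ → y ≡ y′ → z ≡ z′ → f x y z ≡ f x′ y′ z′
cong₃ f refl refl refl = refl

sum-map-*ˡ : ∀ {A : Set} c (f : A → ℕ) xs → sum (map (λ x → c * f x) xs) ≡ c * sum (map f xs)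
sum-map-*ˡ c f [] = sym (*-zeroʳ c)
sum-map-*ˡ c f (x ∷ xs) =
  trans (cong (λ s → c * f x + s) (sum-map-*ˡ c f xs)) (sym (*-distribˡ-+ c (f x) _))

sum-map-+ : ∀ {A : Set} (f g : A → ℕ) xs →
  sum (map (λ x → f x + g x) xs) ≡ sum (map f xs) + sum (map g xs)
sum-map-+ f g [] = refl
sum-map-+ f g (x ∷ xs) =
  trans (cong (λ s → f x + g x + s) (sum-map-+ f g xs))
        (solve 4 (λ p q r s → p :+ q :+ (r :+ s) := p :+ r :+ (q :+ s)) refl (f x) (g x) _ _)

sum-map-zero : ∀ {A : Set} {f : A → ℕ} → (∀ x → f x ≡ 0) → ∀ xs → sum (map f xs) ≡ 0
sum-map-zero f≡0 [] = refl
sum-map-zero f≡0 (x ∷ xs) = cong₂ _+_ (f≡0 x) (sum-map-zero f≡0 xs)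

sum-map-concatMap : ∀ {A B : Set} (f : B → ℕ) (g : A → List B) xs →
  sum (map f (concatMap g xs)) ≡ sum (map (λ x → sum (map f (g x))) xs)
sum-map-concatMap f g [] = refl
sum-map-concatMap f g (x ∷ xs) = begin
  sum (map f (g x ++ concatMap g xs))              ≡⟨ cong sum (map-++ f (g x) _) ⟩
  sum (map f (g x) ++ map f (concatMap g xs))      ≡⟨ sum-++ (map f (g x)) _ ⟩
  sum (map f (g x)) + sum (map f (concatMap g xs))
    ≡⟨ cong (λ s → sum (map f (g x)) + s) (sum-map-concatMap f g xs) ⟩
  sum (map f (g x)) + sum (map (λ y → sum (map f (g y))) xs) ∎
  where open ≡-Reasoning

sum-map-filter : ∀ {A : Set} (P : A → Bool) (f : A → ℕ) xs →
  sum (map f (filter (λ x → P x ≟B true) xs)) ≡ sum (map (λ x → if P x then f x else 0) xs)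
sum-map-filter P f [] = refl
sum-map-filter P f (x ∷ xs) with P x
... | true  = cong (λ s → f x + s) (sum-map-filter P f xs)
... | false = sum-map-filter P f xs

all< : ℕ → (ℕ → Bool) → Bool
all< zero    f = true
all< (suc n) f = f 0 ∧ all< n (λ i → f (suc i))

and-map-applyUpTo : ∀ n (f : ℕ → Bool) g → and (map f (applyUpTo g n)) ≡ all< n (λ i → f (g i))
and-map-applyUpTo zero    f g = refl
and-map-applyUpTo (suc n) f g = cong (f (g 0) ∧_) (and-map-applyUpTo n f (λ i → g (suc i)))

all<-cong : ∀ n {f g : ℕ → Bool} → (∀ i → f i ≡ g i) → all< n f ≡ all< n g
all<-cong zero    f≡g = refl
all<-cong (suc n) f≡g = cong₂ _∧_ (f≡g 0) (all<-cong n (λ i → f≡g (suc i)))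

all<-+ : ∀ m n f → all< (m + n) f ≡ all< m f ∧ all< n (λ i → f (m + i))
all<-+ zero    n f = refl
all<-+ (suc m) n f =
  trans (cong (f 0 ∧_) (all<-+ m n (λ i → f (suc i)))) (sym (∧-assoc (f 0) _ _))

all<-false : ∀ {n f i} → i < n → f i ≡ false → all< n f ≡ false
all<-false {suc n} {f} {zero}  _          fᵢ≡false rewrite fᵢ≡false = refl
all<-false {suc n} {f} {suc i} (s≤s i<n) fᵢ≡false
  rewrite all<-false {n} {λ j → f (suc j)} {i} i<n fᵢ≡false = ∧-zeroʳ (f 0)

Σ≤-suc : ∀ n f → Σ≤ (suc n) f ≡ f 0 + Σ≤ n (λ k → f (suc k))
Σ≤-suc n f = cong (λ s → f 0 + s) (cong sum
  (trans (map-applyUpTo suc f (suc n)) (sym (map-applyUpTo (λ k → k) (λ k → f (suc k)) (suc n)))))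

Σ≤-cong : ∀ n {f g : ℕ → ℕ} → (∀ k → f k ≡ g k) → Σ≤ n f ≡ Σ≤ n g
Σ≤-cong n f≡g = cong sum (map-cong f≡g (upTo (suc n)))

Σ≤-+ : ∀ n f g → Σ≤ n (λ k → f k + g k) ≡ Σ≤ n f + Σ≤ n g
Σ≤-+ n f g = sum-map-+ f g (upTo (suc n))

Σ≤-*ˡ : ∀ n c f → Σ≤ n (λ k → c * f k) ≡ c * Σ≤ n f
Σ≤-*ˡ n c f = sum-map-*ˡ c f (upTo (suc n))

-- delay d (h a b) p is h_{p-d} with the convention h_j = 0 for j < 0.
delay : ℕ → (ℕ → ℕ) → ℕ → ℕ
delay zero    f p       = f p
delay (suc d) f zero    = 0
delay (suc d) f (suc p) = delay d f p

delay-∸ : ∀ q d f p → delay (suc (q + d)) f p ≡ delay (suc d) f (p ∸ q)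
delay-∸ zero    d f p       = refl
delay-∸ (suc q) d f zero    = refl
delay-∸ (suc q) d f (suc p) = delay-∸ q d f p

-- How far to its right a tile may be looked back at by validAt.
reach : Tile → ℕ
reach slR = 1
reach hoR = 2
reach _   = 0

reach≤0⇒≢slR : ∀ x → reach x ≤ 0 → (x == slR) ≡ false
reach≤0⇒≢slR mono _ = refl
reach≤0⇒≢slR slL  _ = refl
reach≤0⇒≢slR hoL  _ = refl

reach≤1⇒≢hoR : ∀ x → reach x ≤ 1 → (x == hoR) ≡ false
reach≤1⇒≢hoR mono _ = refl
reach≤1⇒≢hoR slR  _ = refl
reach≤1⇒≢hoR slL  _ = refl
reach≤1⇒≢hoR hoL  _ = refl
reach≤1⇒≢hoR hoR  (s≤s ())

validAt-∷ : ∀ x t i → reach x ≤ i → validAt (x ∷ t) (suc i) ≡ validAt t i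
validAt-∷ x t zero r with at t zero
... | nothing   = refl
... | just mono = refl
... | just slR  = refl
... | just slL  = reach≤0⇒≢slR x r
... | just hoR  = refl
... | just hoL  = refl
validAt-∷ x t (suc zero) r with at t (suc zero)
... | nothing   = refl
... | just mono = refl
... | just slR  = refl
... | just slL  = refl
... | just hoR  = refl
... | just hoL  = reach≤1⇒≢hoR x r
validAt-∷ x t (suc (suc i)) _ with at t (suc (suc i))
... | nothing   = refl
... | just mono = refl
... | just slR  = refl
... | just slL  = refl
... | just hoR  = refl
... | just hoL  = refl

-- No tile of p is referred to from beyond the end of p.
Closed : List Tile → Set
Closed []      = ⊤
Closed (x ∷ p) = reach x ≤ length p × Closed p

validAt-++ : ∀ p t i → Closed p → validAt (p ++ t) (length p + i) ≡ validAt t i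
validAt-++ []      t i _       = refl
validAt-++ (x ∷ p) t i (r , c) =
  trans (validAt-∷ x (p ++ t) (length p + i) (≤-trans r (m≤m+n (length p) i))) (validAt-++ p t i c)

all<-validAt-++ : ∀ p t n → Closed p →
  all< (length p + n) (validAt (p ++ t)) ≡ all< (length p) (validAt (p ++ t)) ∧ all< n (validAt t)
all<-validAt-++ p t n c =
  trans (all<-+ (length p) n _) (cong (_ ∧_) (all<-cong n (λ i → validAt-++ p t i c)))

count-++ : ∀ x p t → count x (p ++ t) ≡ count x p + count x t
count-++ x []      t = refl
count-++ x (y ∷ p) t with x == y
... | true  = cong suc (count-++ x p t)
... | false = count-++ x p t

colorings-++ : ∀ a b p t → colorings a b (p ++ t) ≡ colorings a b p * colorings a b t
colorings-++ a b p t = begin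
  a ^ count mono (p ++ t) * b ^ (count slR (p ++ t) + count hoR (p ++ t))
    ≡⟨ cong₂ (λ m d → a ^ m * b ^ d) (count-++ mono p t)
         (trans (cong₂ _+_ (count-++ slR p t) (count-++ hoR p t))
                (solve 4 (λ r s u v → r :+ s :+ (u :+ v) := r :+ u :+ (s :+ v)) refl
                   (count slR p) (count slR t) (count hoR p) (count hoR t))) ⟩
  a ^ (mp + mt) * b ^ (dp + dt)
    ≡⟨ cong₂ _*_ (^-distribˡ-+-* a mp mt) (^-distribˡ-+-* b dp dt) ⟩
  (a ^ mp * a ^ mt) * (b ^ dp * b ^ dt)
    ≡⟨ [m*n]*[o*p]≡[m*o]*[n*p] (a ^ mp) (a ^ mt) (b ^ dp) (b ^ dt) ⟩
  colorings a b p * colorings a b t ∎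
  where
    open ≡-Reasoning
    mp mt dp dt : ℕ
    mp = count mono p
    mt = count mono t
    dp = count slR p + count hoR p
    dt = count slR t + count hoR t

Σwords : ℕ → (List Tile → ℕ) → ℕ
Σwords n f = sum (map f (words n))

Σwords-suc : ∀ n f → Σwords (suc n) f ≡ sum (map (λ x → Σwords n (λ t → f (x ∷ t))) allTiles)
Σwords-suc n f = trans (sum-map-concatMap f (λ x → map (x ∷_) (words n)) allTiles)
  (cong sum (map-cong (λ x → cong sum (sym (map-∘ {g = f} {f = x ∷_} (words n)))) allTiles))

Σwords-zero : ∀ n {f} → (∀ t → f t ≡ 0) → Σwords n f ≡ 0
Σwords-zero n f≡0 = sum-map-zero f≡0 (words n)

sum-map-allTiles-single : ∀ x₀ (g : Tile → ℕ) → (∀ x → (x == x₀) ≡ false → g x ≡ 0) →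
  sum (map g allTiles) ≡ g x₀
sum-map-allTiles-single mono g z
  rewrite z slR refl | z slL refl | z hoR refl | z hoL refl = +-identityʳ (g mono)
sum-map-allTiles-single slR g z
  rewrite z mono refl | z slL refl | z hoR refl | z hoL refl = +-identityʳ (g slR)
sum-map-allTiles-single slL g z
  rewrite z mono refl | z slR refl | z hoR refl | z hoL refl = +-identityʳ (g slL)
sum-map-allTiles-single hoR g z
  rewrite z mono refl | z slR refl | z slL refl | z hoL refl = +-identityʳ (g hoR)
sum-map-allTiles-single hoL g z
  rewrite z mono refl | z slR refl | z slL refl | z hoR refl = +-identityʳ (g hoL)

Σwords-forced : ∀ x₀ n f → (∀ x t → (x == x₀) ≡ false → f (x ∷ t) ≡ 0) →
  Σwords (suc n) f ≡ Σwords n (λ t → f (x₀ ∷ t))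
Σwords-forced x₀ n f z = trans (Σwords-suc n f)
  (sum-map-allTiles-single x₀ _ (λ x x≠x₀ → Σwords-zero n (λ t → z x t x≠x₀)))

module Counting (a b : ℕ) where

  -- isTiling with the conjunction unfolded so that it computes on any known prefix of the word.
  weight : ℕ → List Tile → ℕ
  weight n t = if all< n (validAt t) then colorings a b t else 0

  h≡Σweight : ∀ n → h a b n ≡ Σwords n (weight n)
  h≡Σweight n = trans (sum-map-filter (isTiling n) (colorings a b) (words n))
    (cong sum (map-cong (λ t → cong (λ v → if v then colorings a b t else 0)
                                     (and-map-applyUpTo n (validAt t) (λ i → i)))
                        (words n)))

  weight-invalid : ∀ n t i → i < n → validAt t i ≡ false → weight n t ≡ 0
  weight-invalid n t i i<n invalid =
    cong (λ v → if v then colorings a b t else 0) (all<-false {n} {validAt t} i<n invalid)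

  Σweight-block : ∀ p n → Closed p → (∀ t → all< (length p) (validAt (p ++ t)) ≡ true) →
    Σwords n (λ t → weight (length p + n) (p ++ t)) ≡ colorings a b p * h a b n
  Σweight-block p n closed valid = begin
    Σwords n (λ t → weight (length p + n) (p ++ t))
      ≡⟨ cong sum (map-cong weight-++ (words n)) ⟩
    Σwords n (λ t → colorings a b p * weight n t)
      ≡⟨ sum-map-*ˡ (colorings a b p) (weight n) (words n) ⟩
    colorings a b p * Σwords n (weight n)
      ≡⟨ cong (colorings a b p *_) (sym (h≡Σweight n)) ⟩
    colorings a b p * h a b n ∎
    where
      open ≡-Reasoning
      weight-++ : ∀ t → weight (length p + n) (p ++ t) ≡ colorings a b p * weight n t
      weight-++ t rewrite all<-validAt-++ p t n closed | valid t with all< n (validAt t)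
      ... | true  = colorings-++ a b p t
      ... | false = sym (*-zeroʳ (colorings a b p))

  Σweight-slR∷ : ∀ n → Σwords n (λ t → weight (suc n) (slR ∷ t))
    ≡ colorings a b (slR ∷ slL ∷ []) * delay 1 (h a b) n
  Σweight-slR∷ zero    = sym (*-zeroʳ (colorings a b (slR ∷ slL ∷ [])))
  Σweight-slR∷ (suc m) =
    trans (Σwords-forced slL m _ (λ x t → weight-invalid (2 + m) (slR ∷ x ∷ t) 0 (s≤s z≤n)))
          (Σweight-block (slR ∷ slL ∷ []) m (s≤s z≤n , z≤n , tt) (λ _ → refl))

  Σweight-hoR∷hoR∷hoL∷ : ∀ m → Σwords m (λ t → weight (3 + m) (hoR ∷ hoR ∷ hoL ∷ t))
    ≡ colorings a b (hoR ∷ hoR ∷ hoL ∷ hoL ∷ []) * delay 1 (h a b) m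
  Σweight-hoR∷hoR∷hoL∷ zero    = sym (*-zeroʳ (colorings a b (hoR ∷ hoR ∷ hoL ∷ hoL ∷ [])))
  Σweight-hoR∷hoR∷hoL∷ (suc k) =
    trans (Σwords-forced hoL k _
             (λ x t → weight-invalid (4 + k) (hoR ∷ hoR ∷ hoL ∷ x ∷ t) 1 (s≤s (s≤s z≤n))))
          (Σweight-block (hoR ∷ hoR ∷ hoL ∷ hoL ∷ []) k
             (s≤s (s≤s z≤n) , s≤s (s≤s z≤n) , z≤n , z≤n , tt) (λ _ → refl))

  Σweight-hoR∷ : ∀ n → Σwords n (λ t → weight (suc n) (hoR ∷ t))
    ≡ colorings a b (hoR ∷ mono ∷ hoL ∷ []) * delay 2 (h a b) n
      + colorings a b (hoR ∷ hoR ∷ hoL ∷ hoL ∷ []) * delay 3 (h a b) n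
  Σweight-hoR∷ zero          = sym (cong₂ _+_ (*-zeroʳ (colorings a b (hoR ∷ mono ∷ hoL ∷ [])))
                                              (*-zeroʳ (colorings a b (hoR ∷ hoR ∷ hoL ∷ hoL ∷ []))))
  Σweight-hoR∷ (suc zero)    = Σweight-hoR∷ zero
  Σweight-hoR∷ (suc (suc m)) = begin
    Σwords (2 + m) (λ t → weight (3 + m) (hoR ∷ t))
      ≡⟨ Σwords-suc (suc m) _ ⟩
    sum (map (λ y → Σwords (suc m) (λ t → weight (3 + m) (hoR ∷ y ∷ t))) allTiles)
      ≡⟨ cong sum (map-cong (λ y → Σwords-forced hoL m (λ t → weight (3 + m) (hoR ∷ y ∷ t))
                                     (λ x t → weight-invalid (3 + m) (hoR ∷ y ∷ x ∷ t) 0 (s≤s z≤n)))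
                            allTiles) ⟩
    M + (Σwords m (λ t → weight (3 + m) (hoR ∷ slR ∷ hoL ∷ t))
      + (Σwords m (λ t → weight (3 + m) (hoR ∷ slL ∷ hoL ∷ t))
      + (H + (Σwords m (λ t → weight (3 + m) (hoR ∷ hoL ∷ hoL ∷ t)) + 0))))
      ≡⟨ cong₃ (λ u v w → M + (u + (v + (H + (w + 0)))))
               (Σwords-zero m (λ _ → refl)) (Σwords-zero m (λ _ → refl)) (Σwords-zero m (λ _ → refl)) ⟩
    M + (H + 0)
      ≡⟨ cong₂ _+_
           (Σweight-block (hoR ∷ mono ∷ hoL ∷ []) m (s≤s (s≤s z≤n) , z≤n , z≤n , tt) (λ _ → refl))
           (trans (+-identityʳ H) (Σweight-hoR∷hoR∷hoL∷ m)) ⟩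
    colorings a b (hoR ∷ mono ∷ hoL ∷ []) * h a b m
      + colorings a b (hoR ∷ hoR ∷ hoL ∷ hoL ∷ []) * delay 1 (h a b) m ∎
    where
      open ≡-Reasoning
      M H : ℕ
      M = Σwords m (λ t → weight (3 + m) (hoR ∷ mono ∷ hoL ∷ t))
      H = Σwords m (λ t → weight (3 + m) (hoR ∷ hoR ∷ hoL ∷ t))

  h-recurrence : ∀ n → h a b (suc n) ≡ a * h a b n + b * delay 1 (h a b) n
                                       + a * b * delay 2 (h a b) n + b * b * delay 3 (h a b) n
  h-recurrence n = begin
    h a b (suc n)
      ≡⟨ trans (h≡Σweight (suc n)) (Σwords-suc n (weight (suc n))) ⟩
    M + (R + (Σwords n (λ t → weight (suc n) (slL ∷ t))
             + (D + (Σwords n (λ t → weight (suc n) (hoL ∷ t)) + 0))))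
      ≡⟨ cong₂ (λ u v → M + (R + (u + (D + (v + 0)))))
               (Σwords-zero n (λ _ → refl)) (Σwords-zero n (λ _ → refl)) ⟩
    M + (R + (D + 0))
      ≡⟨ cong₃ (λ u v w → u + (v + (w + 0)))
           (Σweight-block (mono ∷ []) n (z≤n , tt) (λ _ → refl)) (Σweight-slR∷ n) (Σweight-hoR∷ n) ⟩
    colorings a b (mono ∷ []) * h a b n + (colorings a b (slR ∷ slL ∷ []) * delay 1 (h a b) n
      + (colorings a b (hoR ∷ mono ∷ hoL ∷ []) * delay 2 (h a b) n
         + colorings a b (hoR ∷ hoR ∷ hoL ∷ hoL ∷ []) * delay 3 (h a b) n + 0))
      -- the block colorings normalise to a·1·1, 1·(b·1), (a·1)·(b·1) and 1·(b·(b·1))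
      ≡⟨ solve 6 (λ A B X Y Z W →
           A :* con 1 :* con 1 :* X :+ (con 1 :* (B :* con 1) :* Y :+ ((A :* con 1) :* (B :* con 1) :* Z
             :+ con 1 :* (B :* (B :* con 1)) :* W :+ con 0))
           := A :* X :+ B :* Y :+ A :* B :* Z :+ B :* B :* W)
         refl a b (h a b n) (delay 1 (h a b) n) (delay 2 (h a b) n) (delay 3 (h a b) n) ⟩
    a * h a b n + b * delay 1 (h a b) n + a * b * delay 2 (h a b) n + b * b * delay 3 (h a b) n ∎
    where
      open ≡-Reasoning
      M R D : ℕ
      M = Σwords n (λ t → weight (suc n) (mono ∷ t))
      R = Σwords n (λ t → weight (suc n) (slR ∷ t))
      D = Σwords n (λ t → weight (suc n) (hoR ∷ t))

Recurrence₂ : ℕ → ℕ → (ℕ → ℕ) → (ℕ → ℕ) → Set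
Recurrence₂ p q g x = ∀ n → x (2 + n) ≡ p * x (1 + n) + q * x n + g n

recurrence₂-unique : ∀ p q {g x y} → Recurrence₂ p q g x → Recurrence₂ p q g y →
  x 0 ≡ y 0 → x 1 ≡ y 1 → ∀ n → x n ≡ y n
recurrence₂-unique p q {g} {x} {y} rec-x rec-y x₀≡y₀ x₁≡y₁ n = proj₁ (agree n)
  where
    agree : ∀ n → x n ≡ y n × x (suc n) ≡ y (suc n)
    agree zero    = x₀≡y₀ , x₁≡y₁
    agree (suc n) with agree n
    ... | xₙ≡yₙ , xₙ₊₁≡yₙ₊₁ = xₙ₊₁≡yₙ₊₁ ,
      trans (rec-x n) (trans (cong₂ (λ u v → p * u + q * v + g n) xₙ₊₁≡yₙ₊₁ xₙ≡yₙ) (sym (rec-y n)))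

module FibonacciConvolution (b : ℕ) where

  φ ψ : ℕ → ℕ
  φ k = b ^ k * fib (suc (suc k))
  ψ k = b ^ k * fib (suc k)

  φ-suc : ∀ k → φ (suc k) ≡ b * φ k + b * ψ k
  φ-suc k = solve 4 (λ B P F₂ F₁ → B :* P :* (F₂ :+ F₁) := B :* (P :* F₂) :+ B :* (P :* F₁))
              refl b (b ^ k) (fib (suc (suc k))) (fib (suc k))

  ψ-suc : ∀ k → ψ (suc k) ≡ b * φ k
  ψ-suc k = *-assoc b (b ^ k) (fib (suc (suc k)))

  ψ-recurrence : Recurrence₂ b (b * b) (λ _ → 0) ψ
  ψ-recurrence n = solve 4 (λ B P F₁ F₀ → B :* (B :* P) :* (F₁ :+ F₀ :+ F₁)
                             := B :* (B :* P :* (F₁ :+ F₀)) :+ B :* B :* (P :* F₁) :+ con 0)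
                     refl b (b ^ n) (fib (suc n)) (fib n)

  conv : (ℕ → ℕ) → (ℕ → ℕ) → ℕ → ℕ
  conv c w n = Σ≤ n (λ k → c k * w (n ∸ k))

  conv-suc : ∀ c w n → conv c w (suc n) ≡ c 0 * w (suc n) + conv (λ k → c (suc k)) w n
  conv-suc c w n = Σ≤-suc n (λ k → c k * w (suc n ∸ k))

  conv-cong : ∀ {c d} w n → (∀ k → c k ≡ d k) → conv c w n ≡ conv d w n
  conv-cong w n c≡d = Σ≤-cong n (λ k → cong (_* w (n ∸ k)) (c≡d k))

  conv-+ : ∀ c d w n → conv (λ k → c k + d k) w n ≡ conv c w n + conv d w n
  conv-+ c d w n = trans (Σ≤-cong n (λ k → *-distribʳ-+ (w (n ∸ k)) (c k) (d k)))
                         (Σ≤-+ n (λ k → c k * w (n ∸ k)) (λ k → d k * w (n ∸ k)))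

  conv-*ˡ : ∀ p c w n → conv (λ k → p * c k) w n ≡ p * conv c w n
  conv-*ˡ p c w n = trans (Σ≤-cong n (λ k → *-assoc p (c k) (w (n ∸ k))))
                          (Σ≤-*ˡ n p (λ k → c k * w (n ∸ k)))

  conv-φ-suc : ∀ w n → conv φ w (suc n) ≡ w (suc n) + (b * conv φ w n + b * conv ψ w n)
  conv-φ-suc w n = trans (conv-suc φ w n) (cong₂ _+_ (*-identityˡ (w (suc n)))
    (trans (conv-cong w n φ-suc)
    (trans (conv-+ (λ k → b * φ k) (λ k → b * ψ k) w n)
           (cong₂ _+_ (conv-*ˡ b φ w n) (conv-*ˡ b ψ w n)))))

  conv-ψ-suc : ∀ w n → conv ψ w (suc n) ≡ w (suc n) + b * conv φ w n
  conv-ψ-suc w n = trans (conv-suc ψ w n) (cong₂ _+_ (*-identityˡ (w (suc n)))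
    (trans (conv-cong w n ψ-suc) (conv-*ˡ b φ w n)))

  conv-φ-recurrence : ∀ w → Recurrence₂ b (b * b) (λ n → w (2 + n) + b * w (1 + n)) (conv φ w)
  conv-φ-recurrence w n = begin
    conv φ w (2 + n)
      ≡⟨ conv-φ-suc w (suc n) ⟩
    w (2 + n) + (b * conv φ w (1 + n) + b * conv ψ w (1 + n))
      ≡⟨ cong (λ v → w (2 + n) + (b * conv φ w (1 + n) + b * v)) (conv-ψ-suc w n) ⟩
    w (2 + n) + (b * conv φ w (1 + n) + b * (w (1 + n) + b * conv φ w n))
      ≡⟨ solve 5 (λ B W₂ W₁ C₁ C₀ → W₂ :+ (B :* C₁ :+ B :* (W₁ :+ B :* C₀))
                   := B :* C₁ :+ B :* B :* C₀ :+ (W₂ :+ B :* W₁))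
           refl b (w (2 + n)) (w (1 + n)) (conv φ w (1 + n)) (conv φ w n) ⟩
    b * conv φ w (1 + n) + b * b * conv φ w n + (w (2 + n) + b * w (1 + n)) ∎
    where open ≡-Reasoning

module Interleaving (a b : ℕ) where

  open FibonacciConvolution b

  odd-positions-recurrence : ∀ (u : ℕ → ℕ) →
    (∀ m → u (4 + m) ≡ a * u (3 + m) + b * u (2 + m) + a * b * u (1 + m) + b * b * u m) →
    Recurrence₂ b (b * b) (λ n → a * (u (2 * (2 + n)) + b * u (2 * (1 + n)))) (λ j → u (suc (2 * j)))
  odd-positions-recurrence u rec n rewrite *-suc 2 (suc n) | *-suc 2 n =
    trans (rec (suc (2 * n)))
      (solve 6 (λ A B U₄ U₃ U₂ U₁ → A :* U₄ :+ B :* U₃ :+ A :* B :* U₂ :+ B :* B :* U₁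
                 := B :* U₃ :+ B :* B :* U₁ :+ A :* (U₄ :+ B :* U₂))
         refl a b (u (4 + 2 * n)) (u (3 + 2 * n)) (u (2 + 2 * n)) (u (1 + 2 * n)))

  conv-solution : ∀ (f w x : ℕ → ℕ) → Recurrence₂ b (b * b) (λ _ → 0) f →
    Recurrence₂ b (b * b) (λ n → a * (w (2 + n) + b * w (1 + n))) x →
    x 0 ≡ f 0 + a * conv φ w 0 → x 1 ≡ f 1 + a * conv φ w 1 →
    ∀ n → x n ≡ f n + a * conv φ w n
  conv-solution f w x rec-f rec-x = recurrence₂-unique b (b * b) rec-x rec-rhs
    where
      rhs : ℕ → ℕ
      rhs n = f n + a * conv φ w n

      rec-rhs : Recurrence₂ b (b * b) (λ n → a * (w (2 + n) + b * w (1 + n))) rhs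
      rec-rhs n = begin
        f (2 + n) + a * conv φ w (2 + n)
          ≡⟨ cong₂ (λ u v → u + a * v) (rec-f n) (conv-φ-recurrence w n) ⟩
        b * F₁ + b * b * F₀ + 0 + a * (b * C₁ + b * b * C₀ + (w (2 + n) + b * w (1 + n)))
          ≡⟨ solve 8 (λ A B F₁ F₀ C₁ C₀ W₂ W₁ →
               B :* F₁ :+ B :* B :* F₀ :+ con 0 :+ A :* (B :* C₁ :+ B :* B :* C₀ :+ (W₂ :+ B :* W₁))
               := B :* (F₁ :+ A :* C₁) :+ B :* B :* (F₀ :+ A :* C₀) :+ A :* (W₂ :+ B :* W₁))
               refl a b F₁ F₀ C₁ C₀ (w (2 + n)) (w (1 + n)) ⟩
        b * rhs (1 + n) + b * b * rhs n + a * (w (2 + n) + b * w (1 + n)) ∎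
        where
          open ≡-Reasoning
          F₁ F₀ C₁ C₀ : ℕ
          F₁ = f (1 + n)
          F₀ = f n
          C₁ = conv φ w (1 + n)
          C₀ = conv φ w n

hℤ-⊖ : ∀ a b p d → hℤ a b (p ⊖ d) ≡ delay d (h a b) p
hℤ-⊖ a b p       zero    = refl
hℤ-⊖ a b zero    (suc d) = refl
hℤ-⊖ a b (suc p) (suc d) = trans (cong (hℤ a b) ([1+m]⊖[1+n]≡m⊖n p d)) (hℤ-⊖ a b p d)

hℤ-[p-q]-[1+d] : ∀ a b p q d → hℤ a b ((+ p -ℤ + q) -ℤ + suc d) ≡ delay (suc d) (h a b) (p ∸ q)
hℤ-[p-q]-[1+d] a b p q d = begin
  hℤ a b ((+ p -ℤ + q) +ℤ -[1+ d ]) ≡⟨ cong (λ i → hℤ a b (i +ℤ -[1+ d ])) ([+m]-[+n]≡m⊖n p q) ⟩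
  hℤ a b (p ⊖ q +ℤ -[1+ d ])        ≡⟨ cong (hℤ a b) (distribˡ-⊖-+-neg d p q) ⟩
  hℤ a b (p ⊖ suc (q + d))          ≡⟨ hℤ-⊖ a b p (suc (q + d)) ⟩
  delay (suc (q + d)) (h a b) p     ≡⟨ delay-∸ q d (h a b) p ⟩
  delay (suc d) (h a b) (p ∸ q)     ∎
  where open ≡-Reasoning

module Honeycomb (a b : ℕ) where

  open Counting a b using (h-recurrence)
  open FibonacciConvolution b
  open Interleaving a b

  h₁ : h a b 1 ≡ a
  h₁ = trans (h-recurrence 0)
    (solve 2 (λ A B → A :* con 1 :+ B :* con 0 :+ A :* B :* con 0 :+ B :* B :* con 0 := A) refl a b)

  h₂ : h a b 2 ≡ a * a + b
  h₂ = trans (h-recurrence 1) (trans (cong (λ v → a * v + b * 1 + a * b * 0 + b * b * 0) h₁)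
    (solve 2 (λ A B → A :* A :+ B :* con 1 :+ A :* B :* con 0 :+ B :* B :* con 0 := A :* A :+ B) refl a b))

  h-even : ∀ n → h a b (2 * n) ≡ ψ n + a * conv φ (λ j → delay 1 (h a b) (2 * j)) n
  h-even = conv-solution ψ _ _ ψ-recurrence
    (odd-positions-recurrence (delay 1 (h a b)) (λ m → h-recurrence (2 + m)))
    (sym (cong (λ v → 1 + v) (*-zeroʳ a)))
    (trans h₂ (sym (trans (cong₂ (λ u v → b * 1 * 1 + a * (1 * u + (v + 0))) h₁ (*-zeroʳ (φ 1)))
      (solve 2 (λ A B → B :* con 1 :* con 1 :+ A :* (con 1 :* A :+ (con 0 :+ con 0)) := A :* A :+ B)
             refl a b))))

  h-odd : ∀ n → delay 1 (h a b) (2 * n) ≡ a * conv φ (λ j → delay 2 (h a b) (2 * j)) n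
  h-odd = conv-solution (λ _ → 0) _ _
    (λ _ → sym (solve 1 (λ B → B :* con 0 :+ B :* B :* con 0 :+ con 0 := con 0) refl b))
    (odd-positions-recurrence (delay 2 (h a b)) (λ m → h-recurrence (1 + m)))
    (sym (*-zeroʳ a))
    (trans h₁ (sym (trans (cong (λ v → a * (1 + (v + 0))) (*-zeroʳ (φ 1)))
      (solve 1 (λ A → A :* (con 1 :+ (con 0 :+ con 0)) := A) refl a))))

  Σ≤-hℤ≡conv : ∀ n d → Σ≤ n (λ k → b ^ k * hℤ a b ((+ (2 * n) -ℤ + (2 * k)) -ℤ + suc d) * fib (k + 2))
                      ≡ conv φ (λ j → delay (suc d) (h a b) (2 * j)) n
  Σ≤-hℤ≡conv n d = Σ≤-cong n summand
    where
      summand : ∀ k → b ^ k * hℤ a b ((+ (2 * n) -ℤ + (2 * k)) -ℤ + suc d) * fib (k + 2)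
                    ≡ φ k * delay (suc d) (h a b) (2 * (n ∸ k))
      summand k = trans
        (cong₂ (λ u v → b ^ k * u * v)
          (trans (hℤ-[p-q]-[1+d] a b (2 * n) (2 * k) d)
                 (cong (delay (suc d) (h a b)) (sym (*-distribˡ-∸ 2 n k))))
          (cong fib (+-comm k 2)))
        (solve 3 (λ P H F → P :* H :* F := P :* F :* H) refl
          (b ^ k) (delay (suc d) (h a b) (2 * (n ∸ k))) (fib (suc (suc k))))

theorem7 : (a b : ℕ) → a ≥ 1 → b ≥ 1 → (n : ℕ) →
    (h a b (2 * n) ≡ b ^ n * fib (n + 1)
        + a * Σ≤ n (λ k → b ^ k * hℤ a b ((+ (2 * n) -ℤ + (2 * k)) -ℤ + 1) * fib (k + 2)))
    × (hℤ a b (+ (2 * n) -ℤ + 1)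
        ≡ a * Σ≤ n (λ k → b ^ k * hℤ a b ((+ (2 * n) -ℤ + (2 * k)) -ℤ + 2) * fib (k + 2)))
theorem7 a b _ _ n =
    trans (h-even n) (cong₂ (λ u v → b ^ n * fib u + a * v) (+-comm 1 n) (sym (Σ≤-hℤ≡conv n 0)))
  , trans (trans (cong (hℤ a b) ([+m]-[+n]≡m⊖n (2 * n) 1)) (hℤ-⊖ a b (2 * n) 1))
          (trans (h-odd n) (cong (a *_) (sym (Σ≤-hℤ≡conv n 1))))
  where open Honeycomb a b
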